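{- For every positive integer $M$ there are only finitely many composite almost-prime numbers having exactly $M$ distinct prime divisors.
   Context: For a positive integer $n$ with positive divisors $1=d_1<d_2<\dots<d_k=n$, define the polynomial $T_n(x)=x^{d_1}+x^{d_2}+\dots+x^{d_k}-kx$. A positive integer $n$ is called weakly almost-prime if $n\mid T_n(x)$ for all integers $x$; it is called almost-prime if it is weakly almost-prime and square-free. -}

module Defs where

open import Data.Nat using (ℕ; suc; _≤_; _<_)
open import Data.Nat.Divisibility using (_∣_; _∣?_)
open import Data.Nat.Primality using (Prime; prime?)
open import Data.List using (List; filter; length; upTo; map; foldr)
open import Data.Integer as ℤ using (ℤ; +_)
import Data.Integer.Divisibility as ℤd
open import Data.Product using (_×_)
open import Relation.Nullary using (¬_)

divisors : ℕ → List ℕ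
divisors n = filter (λ d → d ∣? n) (map suc (upTo n))

T : ℕ → ℤ → ℤ
T n x = foldr (λ d acc → (x ℤ.^ d) ℤ.+ acc) (+ 0) (divisors n)
        ℤ.- ((+ length (divisors n)) ℤ.* x)

WeaklyAlmostPrime : ℕ → Set
WeaklyAlmostPrime n = (1 ≤ n) × (∀ (x : ℤ) → (+ n) ℤd.∣ T n x)

SquareFree : ℕ → Set
SquareFree n = ∀ p → Prime p → ¬ (p Data.Nat.* p ∣ n)

AlmostPrime : ℕ → Set
AlmostPrime n = WeaklyAlmostPrime n × SquareFree n

ω : ℕ → ℕ
ω n = length (filter (λ p → prime? p) (divisors n))

-- Let n be a composite almost-prime and p a prime factor of n. By Fermat's little theorem p divides
-- every value of Σ_{d ∣ n} x^{r(d)} − τ(n)·x, where r(d) ∈ {1, …, p − 1} is d reduced modulo p − 1.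
-- If p > τ(n), this polynomial has fewer than p terms and all exponents below p, and finite
-- differences show that it can only vanish modulo p if every r(d) is ≤ 1: every divisor d ≥ 2 of n
-- is ≡ 1 (mod p − 1), in particular d ≥ p. For a second prime factor q of the square-free n this
-- gives p < q, hence also q > τ(n) and so q ≤ p. Therefore every prime factor of n is at most
-- τ(n) = 2^ω(n), and the square-free n divides (2^M)!.

module Submission where

open import Defs
open import Data.Nat using (ℕ; zero; suc; _≤_; _<_; _!)
open import Data.Nat.Primality using (Prime; Composite)
open import Data.Product using (∃-syntax; _,_; _×_; proj₁; proj₂)
open import Data.Sum using (inj₁; inj₂)
open import Data.Empty using (⊥-elim)
open import Data.List using (List; []; _∷_; length; map; filter)
open import Data.List.Membership.Propositional using (_∈_)
open import Data.List.Relation.Unary.All as All using (All; []; _∷_)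
open import Relation.Nullary using (¬_; yes; no)
open import Relation.Binary.PropositionalEquality
import Data.Nat as ℕ
import Data.Nat.Properties as ℕ
import Data.Nat.Divisibility as ℕ

-- Primes, factorials and square-free numbers

module _ where
  open import Data.Nat using (_*_; _∸_; z≤n; s≤s; ≢-nonZero; nonTrivial⇒n>1)
  open import Data.Nat.Properties
  open import Data.Nat.Induction using (<-rec)
  open import Data.Nat.DivMod using (m*[n/m]≡n)
  open import Data.Nat.Divisibility
    using (_∣_; divides; _∣0; 1∣_; ∣-trans; m∣m*n; ∣1⇒≡1; ∣⇒≤; m≤n⇒m!∣n!)
  open import Data.Sum using ([_,_]′)
  open import Function using (id; _∘_)
  open import Data.Nat.Primality
    using (prime[2]; euclidsLemma; prime⇒nonTrivial; ¬composite[0]; composite⇒¬prime)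
  open import Data.Nat.Primality.Factorisation using (factorise)
  open import Data.Nat.ListAction using (product)
  open import Data.Nat.Combinatorics using (_C_; nCk≡n!/k![n-k]!; k![n∸k]!∣n!)

  prime⇒>1 : ∀ {p} → Prime p → 1 < p
  prime⇒>1 {p} p-prime = nonTrivial⇒n>1 p {{prime⇒nonTrivial p-prime}}

  prime∣n!⇒≤ : ∀ {p} n → Prime p → p ∣ n ! → p ≤ n
  prime∣n!⇒≤ zero    p-prime p∣1 = ⊥-elim (<⇒≢ (prime⇒>1 p-prime) (sym (∣1⇒≡1 p∣1)))
  prime∣n!⇒≤ (suc n) p-prime p∣n! with euclidsLemma (suc n) (n !) p-prime p∣n!
  ... | inj₁ p∣1+n = ∣⇒≤ p∣1+n
  ... | inj₂ p∣n!′ = m≤n⇒m≤1+n (prime∣n!⇒≤ n p-prime p∣n!′)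

  prime∤n! : ∀ {p n} → Prime p → n < p → ¬ p ∣ n !
  prime∤n! p-prime n<p p∣n! = <⇒≱ n<p (prime∣n!⇒≤ _ p-prime p∣n!)

  m≤n⇒m∣n! : ∀ {m n} → 0 < m → m ≤ n → m ∣ n !
  m≤n⇒m∣n! {suc m} _ m≤n = ∣-trans (m∣m*n (m !)) (m≤n⇒m!∣n! m≤n)

  prime∣pCk : ∀ {p k} → Prime p → 0 < k → k < p → p ∣ p C k
  prime∣pCk {p} {k} p-prime 0<k k<p =
    [ ⊥-elim ∘ p∤k!*[p∸k]! , id ]′ (euclidsLemma (k ! * (p ∸ k) !) (p C k) p-prime p∣p!)
    where
    instance _ = k !* (p ∸ k) !≢0
    p∣p! : p ∣ k ! * (p ∸ k) ! * (p C k)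
    p∣p! = subst (p ∣_) (sym (trans (cong (k ! * (p ∸ k) ! *_) (nCk≡n!/k![n-k]! (<⇒≤ k<p)))
                                     (m*[n/m]≡n (k![n∸k]!∣n! (<⇒≤ k<p)))))
                 (m≤n⇒m∣n! (<-trans 0<k k<p) ≤-refl)
    p∤k!*[p∸k]! : ¬ p ∣ k ! * (p ∸ k) !
    p∤k!*[p∸k]! p∣k!*[p∸k]! =
      [ prime∤n! p-prime k<p , prime∤n! p-prime (∸-monoʳ-< 0<k (<⇒≤ k<p)) ]′
        (euclidsLemma (k !) ((p ∸ k) !) p-prime p∣k!*[p∸k]!)

  prime-divisor : ∀ {m} → 2 ≤ m → ∃[ q ] Prime q × q ∣ m
  prime-divisor {suc m} 2≤m with factorise (suc m)
  ... | record { factors = [] ; isFactorisation = m≡1 } = ⊥-elim (<⇒≢ 2≤m (sym m≡1))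
  ... | record { factors = q ∷ qs ; isFactorisation = m≡q*qs ; factorsPrime = q-prime ∷ _ } =
    q , q-prime , divides (product qs) (trans m≡q*qs (*-comm q (product qs)))

  cofactor≥2 : ∀ {n p m} → Composite n → Prime p → n ≡ m * p → 2 ≤ m
  cofactor≥2 {m = zero}        n-composite _       refl = ⊥-elim (¬composite[0] n-composite)
  cofactor≥2 {p = p} {suc zero} n-composite p-prime refl =
    ⊥-elim (composite⇒¬prime n-composite (subst Prime (sym (+-identityʳ p)) p-prime))
  cofactor≥2 {m = suc (suc _)} _           _       _    = s≤s (s≤s z≤n)

  *-prime-∣ : ∀ {p m N} → Prime p → ¬ p ∣ m → p ∣ N → m ∣ N → m * p ∣ N
  *-prime-∣ {p} {m} {N} p-prime p∤m p∣N (divides t N≡t*m)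
    with euclidsLemma t m p-prime (subst (p ∣_) N≡t*m p∣N)
  ... | inj₂ p∣m = ⊥-elim (p∤m p∣m)
  ... | inj₁ (divides s t≡s*p) = divides s (begin
    N           ≡⟨ N≡t*m ⟩
    t * m       ≡⟨ cong (_* m) t≡s*p ⟩
    s * p * m   ≡⟨ *-assoc s p m ⟩
    s * (p * m) ≡⟨ cong (s *_) (*-comm p m) ⟩
    s * (m * p) ∎)
    where open ≡-Reasoning

  squarefree-∣ : ∀ d {N} → SquareFree d → (∀ p → Prime p → p ∣ d → p ∣ N) → d ∣ N
  squarefree-∣ = <-rec P step
    where
    P : ℕ → Set
    P d = ∀ {N} → SquareFree d → (∀ p → Prime p → p ∣ d → p ∣ N) → d ∣ N
    step : ∀ d → (∀ {m} → m < d → P m) → P d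
    step zero                _   sf _ = ⊥-elim (sf 2 prime[2] (4 ∣0))
    step (suc zero)          _   _  _ = 1∣ _
    step d@(suc (suc _)) rec {N} sf p∣d⇒p∣N with prime-divisor {d} (s≤s (s≤s z≤n))
    ... | p , p-prime , p∣d@(divides m d≡m*p) =
      subst (_∣ N) (sym d≡m*p) (*-prime-∣ p-prime p∤m (p∣d⇒p∣N p p-prime p∣d) m∣N)
      where
      m∣d : m ∣ d
      m∣d = divides p (trans d≡m*p (*-comm m p))
      p∤m : ¬ p ∣ m
      p∤m (divides k m≡k*p) =
        sf p p-prime (divides k (trans d≡m*p (trans (cong (_* p) m≡k*p) (*-assoc k p p))))
      m≢0 : m ≢ 0
      m≢0 m≡0 = 1+n≢0 (trans d≡m*p (cong (_* p) m≡0))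
      m<d : m < d
      m<d = subst (m <_) (sym d≡m*p) (m<m*n m p {{≢-nonZero m≢0}} (prime⇒>1 p-prime))
      m∣N : m ∣ N
      m∣N = rec m<d (λ q q-prime q²∣m → sf q q-prime (∣-trans q²∣m m∣d))
                    (λ q q-prime q∣m → p∣d⇒p∣N q q-prime (∣-trans q∣m m∣d))

-- Fermat's little theorem and reduction of exponents

module _ where
  open import Data.Nat using (_+_; _*_; _^_; _∸_; _%_; _/_; NonZero; z≤n; s≤s; >-nonZero)
  open import Data.Nat.Properties
  open import Data.Nat.DivMod using (%-distribˡ-+; %-distribˡ-*; %-remove-+ˡ; m%n<n; m≡m%n+[m/n]*n)
  open import Data.Nat.Divisibility using (_∣_; _∣0; ∣m∣n⇒∣m+n; ∣m⇒∣m*n; ∣⇒≤; m%n≡0⇒n∣m)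
  open import Data.Nat.Primality using (prime⇒nonZero)
  open import Data.Nat.Combinatorics using (_C_; nCn≡1)
  open import Data.Nat.Tactic.RingSolver using (solve-∀)
  open import Data.Fin using (toℕ; inject₁) renaming (zero to 0F; suc to 1+)
  import Data.Fin.Properties as Fin
  open import Data.Vec.Functional using (Vector; tail; init; last)
  open import Function using (_∘_)
  open import Algebra.Bundles using (CommutativeSemiring)
  open CommutativeSemiring +-*-commutativeSemiring using (semiring; rawSemiring)
  open import Algebra.Properties.CommutativeSemiring.Binomial +-*-commutativeSemiring
    using (binomialTerm) renaming (theorem to binomial-theorem)
  open import Algebra.Properties.Semiring.Sum semiring using (sum; sum-init-last)
  open import Algebra.Definitions.RawSemiring rawSemiring
    using () renaming (_×_ to _×ᴿ_; _^_ to _^ᴿ_)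
  open ≡-Reasoning

  %-congʳ-+ : ∀ {d} .{{_ : NonZero d}} c {a b} → a % d ≡ b % d → (c + a) % d ≡ (c + b) % d
  %-congʳ-+ {d} c {a} {b} a≡b = begin
    (c + a) % d          ≡⟨ %-distribˡ-+ c a d ⟩
    (c % d + a % d) % d  ≡⟨ cong (λ r → (c % d + r) % d) a≡b ⟩
    (c % d + b % d) % d  ≡⟨ %-distribˡ-+ c b d ⟨
    (c + b) % d          ∎

  %-congʳ-* : ∀ {d} .{{_ : NonZero d}} c {a b} → a % d ≡ b % d → (c * a) % d ≡ (c * b) % d
  %-congʳ-* {d} c {a} {b} a≡b = begin
    (c * a) % d            ≡⟨ %-distribˡ-* c a d ⟩
    (c % d * (a % d)) % d  ≡⟨ cong (λ r → (c % d * r) % d) a≡b ⟩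
    (c % d * (b % d)) % d  ≡⟨ %-distribˡ-* c b d ⟨
    (c * b) % d            ∎

  -- The library's binomial theorem uses the generic semiring power and ℕ-multiple, which agree
  -- with ℕ's _^_ and _*_ only propositionally.
  ^ᴿ≗^ : ∀ a n → a ^ᴿ n ≡ a ^ n
  ^ᴿ≗^ a zero    = refl
  ^ᴿ≗^ a (suc n) = cong (a *_) (^ᴿ≗^ a n)

  ×ᴿ≗* : ∀ n a → n ×ᴿ a ≡ n * a
  ×ᴿ≗* zero    a = refl
  ×ᴿ≗* (suc n) a = cong (a +_) (×ᴿ≗* n a)

  ∣-sum : ∀ {d n} (f : Vector ℕ n) → (∀ i → d ∣ f i) → d ∣ sum f
  ∣-sum {n = zero}  f _   = _ ∣0
  ∣-sum {n = suc n} f d∣f = ∣m∣n⇒∣m+n (d∣f 0F) (∣-sum (tail f) (d∣f ∘ 1+))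

  [1+a]^n%d≡[1+a^n]%d : ∀ {d} .{{_ : NonZero d}} n a → 0 < n →
                        (∀ {k} → 0 < k → k < n → d ∣ n C k) → (1 + a) ^ n % d ≡ (1 + a ^ n) % d
  [1+a]^n%d≡[1+a^n]%d {d} n@(suc m) a _ d∣nCk = begin
    (1 + a) ^ n % d              ≡⟨ cong (_% d) expansion ⟩
    (a ^ n + (middle + 1)) % d   ≡⟨ cong (_% d) (lemma (a ^ n) middle) ⟩
    (middle + (1 + a ^ n)) % d   ≡⟨ %-remove-+ˡ (1 + a ^ n) (∣-sum (init (tail t)) d∣middle) ⟩
    (1 + a ^ n) % d              ∎
    where
    lemma : ∀ x y → x + (y + 1) ≡ y + (1 + x)
    lemma = solve-∀
    t : Vector ℕ (suc n)
    t = binomialTerm 1 a n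
    middle : ℕ
    middle = sum (init (tail t))
    d∣middle : ∀ j → d ∣ init (tail t) j
    d∣middle j = subst (d ∣_) (sym (×ᴿ≗* (n C suc i) _)) (∣m⇒∣m*n _ (d∣nCk (s≤s z≤n) (s≤s i<m)))
      where
      i = toℕ (inject₁ j)
      i<m : i < m
      i<m = subst (_< m) (sym (Fin.toℕ-inject₁ j)) (Fin.toℕ<n j)
    first : t 0F ≡ a ^ n
    first = trans (+-identityʳ _) (trans (+-identityʳ _) (^ᴿ≗^ a n))
    final : last (tail t) ≡ 1
    final rewrite Fin.toℕ-fromℕ m | nCn≡1 n | n∸n≡0 m | ^ᴿ≗^ 1 n | ^-zeroˡ n = refl
    expansion : (1 + a) ^ n ≡ a ^ n + (middle + 1)
    expansion = begin
      (1 + a) ^ n                       ≡⟨ ^ᴿ≗^ (1 + a) n ⟨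
      (1 + a) ^ᴿ n                      ≡⟨ binomial-theorem n 1 a ⟩
      t 0F + sum (tail t)               ≡⟨ cong₂ _+_ first (sum-init-last (tail t)) ⟩
      a ^ n + (middle + last (tail t))  ≡⟨ cong (λ r → a ^ n + (middle + r)) final ⟩
      a ^ n + (middle + 1)              ∎

  module _ {p} (p-prime : Prime p) where
    private instance
      p≢0 : NonZero p
      p≢0 = prime⇒nonZero p-prime
      p∸1≢0 : NonZero (p ∸ 1)
      p∸1≢0 = >-nonZero (m<n⇒0<n∸m (prime⇒>1 p-prime))

    fermat : ∀ a → a ^ p % p ≡ a % p
    fermat zero    = cong (_% p) (0^n≡0 p)
      where
      0^n≡0 : ∀ n .{{_ : NonZero n}} → 0 ^ n ≡ 0
      0^n≡0 (suc n) = refl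
    fermat (suc a) = begin
      (1 + a) ^ p % p  ≡⟨ [1+a]^n%d≡[1+a^n]%d p a 0<p (prime∣pCk p-prime) ⟩
      (1 + a ^ p) % p  ≡⟨ %-congʳ-+ {p} 1 (fermat a) ⟩
      (1 + a) % p      ∎
      where
      0<p = <-trans (s≤s z≤n) (prime⇒>1 p-prime)

    -- The representative in {1, …, p − 1} of an exponent d ≥ 1 modulo p − 1.
    reduce : ℕ → ℕ
    reduce d = suc ((d ∸ 1) % (p ∸ 1))

    reduce<p : ∀ d → reduce d < p
    reduce<p d = subst (suc (reduce d) ≤_) (suc-pred p) (s≤s (m%n<n (d ∸ 1) (p ∸ 1)))

    reduce≤1⇒p≤d : ∀ {d} → 2 ≤ d → reduce d ≤ 1 → p ≤ d
    reduce≤1⇒p≤d {suc d} (s≤s 1≤d) (s≤s r≡0) =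
      subst (_≤ suc d) (suc-pred p)
            (s≤s (∣⇒≤ {{>-nonZero 1≤d}} (m%n≡0⇒n∣m d (p ∸ 1) (n≤0⇒n≡0 r≡0))))

    ^-reduce : ∀ a {d} → 0 < d → a ^ d % p ≡ a ^ reduce d % p
    ^-reduce a {suc d} _ = begin
      a ^ suc d % p                            ≡⟨ cong (λ e → a ^ suc e % p) (m≡m%n+[m/n]*n d (p ∸ 1)) ⟩
      a ^ suc (r + d / (p ∸ 1) * (p ∸ 1)) % p  ≡⟨ periodic (d / (p ∸ 1)) ⟩
      a ^ suc r % p                            ∎
      where
      r = d % (p ∸ 1)
      periodic : ∀ k → a ^ suc (r + k * (p ∸ 1)) % p ≡ a ^ suc r % p
      periodic zero    = cong (λ e → a ^ suc e % p) (+-identityʳ r)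
      periodic (suc k) = begin
        a ^ suc (r + (p ∸ 1 + k * (p ∸ 1))) % p  ≡⟨ cong (λ e → a ^ e % p) exponent ⟩
        a ^ (m + p) % p                          ≡⟨ cong (_% p) (^-distribˡ-+-* a m p) ⟩
        a ^ m * a ^ p % p                        ≡⟨ %-congʳ-* {p} (a ^ m) (fermat a) ⟩
        a ^ m * a % p                            ≡⟨ cong (_% p) (*-comm (a ^ m) a) ⟩
        a ^ suc m % p                            ≡⟨ periodic k ⟩
        a ^ suc r % p                            ∎
        where
        m = r + k * (p ∸ 1)
        lemma : ∀ r k q → suc (r + (q + k * q)) ≡ r + k * q + suc q
        lemma = solve-∀
        exponent : suc (r + (p ∸ 1 + k * (p ∸ 1))) ≡ m + p
        exponent = trans (lemma r k (p ∸ 1)) (cong (m +_) (suc-pred p))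

-- Counting divisors

module _ where
  open import Data.Nat using (_+_; _^_; _≟_; z≤n; s≤s; >-nonZero)
  open import Data.Nat.Properties
  open import Data.Nat.Divisibility using (_∣_; _∣?_; ∣-trans; ∣⇒≤; ∣-antisym; 0∣⇒≡0)
  open import Data.Nat.Primality using (prime?)
  open import Data.List using (upTo; _++_)
  import Data.List.Properties as List
  open import Data.List.Membership.Propositional.Properties
    using (∈-filter⁺; ∈-filter⁻; ∈-map⁺; ∈-map⁻; ∈-upTo⁺; ∈-++⁺ˡ; ∈-++⁺ʳ)
  open import Data.List.Relation.Unary.Any as Any using (here; there)
  open import Data.List.Relation.Unary.Unique.Propositional using (Unique)
  open import Data.List.Relation.Unary.AllPairs using (_∷_)
  import Data.List.Relation.Unary.Unique.Propositional.Properties as Unique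
  open import Data.Bool using (true; false)
  open import Relation.Binary.Definitions using (DecidableEquality)
  open import Relation.Nullary using (¬?; does)
  open import Relation.Unary using (Decidable)

  sublists : ∀ {A : Set} → List A → List (List A)
  sublists []       = [] ∷ []
  sublists (x ∷ xs) = map (x ∷_) (sublists xs) ++ sublists xs

  length-sublists : ∀ {A : Set} (xs : List A) → length (sublists xs) ≡ 2 ^ length xs
  length-sublists []       = refl
  length-sublists (x ∷ xs) = begin
    length (map (x ∷_) (sublists xs) ++ sublists xs)
      ≡⟨ List.length-++ (map (x ∷_) (sublists xs)) ⟩
    length (map (x ∷_) (sublists xs)) + length (sublists xs)
      ≡⟨ cong (_+ length (sublists xs)) (List.length-map (x ∷_) (sublists xs)) ⟩
    length (sublists xs) + length (sublists xs)
      ≡⟨ cong₂ _+_ (length-sublists xs) (length-sublists xs) ⟩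
    2 ^ length xs + 2 ^ length xs
      ≡⟨ cong (2 ^ length xs +_) (+-identityʳ (2 ^ length xs)) ⟨
    2 ^ suc (length xs) ∎
    where open ≡-Reasoning

  filter∈sublists : ∀ {A : Set} {P : A → Set} (P? : Decidable P) xs → filter P? xs ∈ sublists xs
  filter∈sublists P? []       = here refl
  filter∈sublists P? (x ∷ xs) with does (P? x)
  ... | true  = ∈-++⁺ˡ (∈-map⁺ (x ∷_) (filter∈sublists P? xs))
  ... | false = ∈-++⁺ʳ (map (x ∷_) (sublists xs)) (filter∈sublists P? xs)

  injection⇒length≤ : ∀ {A B : Set} → DecidableEquality B → (f : A → B) {xs : List A} {ys : List B} →
                      Unique xs → (∀ {x y} → x ∈ xs → y ∈ xs → f x ≡ f y → x ≡ y) →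
                      (∀ {x} → x ∈ xs → f x ∈ ys) → length xs ≤ length ys
  injection⇒length≤ _≟_ f {[]}          _            _   _    = z≤n
  injection⇒length≤ _≟_ f {x ∷ xs} {ys} (x∉xs ∷ xs!) inj f∈ys =
    ≤-trans (s≤s (injection⇒length≤ _≟_ f xs! (λ x∈ y∈ → inj (there x∈) (there y∈)) f[xs]∈ys′)) ys′<ys
    where
    other? = λ y → ¬? (y ≟ f x)
    ys′ = filter other? ys
    ys′<ys : length ys′ < length ys
    ys′<ys = List.filter-notAll other? ys (Any.map (λ fx≡y fx≢y → fx≢y (sym fx≡y)) (f∈ys (here refl)))
    f[xs]∈ys′ : ∀ {y} → y ∈ xs → f y ∈ ys′
    f[xs]∈ys′ y∈xs = ∈-filter⁺ other? (f∈ys (there y∈xs))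
                       (λ fy≡fx → All.lookup x∉xs y∈xs (inj (here refl) (there y∈xs) (sym fy≡fx)))

  ∈-divisors⁺ : ∀ {n d} → 0 < n → d ∣ n → d ∈ divisors n
  ∈-divisors⁺ {n} {zero}  0<n 0∣n = ⊥-elim (<⇒≢ 0<n (sym (0∣⇒≡0 0∣n)))
  ∈-divisors⁺ {n} {suc d} 0<n d∣n =
    ∈-filter⁺ (_∣? n) (∈-map⁺ suc (∈-upTo⁺ (∣⇒≤ {{>-nonZero 0<n}} d∣n))) d∣n

  ∈-divisors⁻ : ∀ {n d} → d ∈ divisors n → d ∣ n
  ∈-divisors⁻ {n} d∈ = proj₂ (∈-filter⁻ (_∣? n) {xs = map suc (upTo n)} d∈)

  divisors-positive : ∀ n → All (0 <_) (divisors n)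
  divisors-positive n = All.tabulate positive
    where
    positive : ∀ {d} → d ∈ divisors n → 0 < d
    positive d∈ with ∈-map⁻ suc (proj₁ (∈-filter⁻ (_∣? n) {xs = map suc (upTo n)} d∈))
    ... | _ , _ , refl = s≤s z≤n

  divisors-unique : ∀ n → Unique (divisors n)
  divisors-unique n = Unique.filter⁺ (_∣? n) (Unique.map⁺ suc-injective (Unique.upTo⁺ n))

  -- A divisor of the square-free n is determined by the set of primes dividing it.
  length-divisors≤2^ω : ∀ {n} → 0 < n → SquareFree n → length (divisors n) ≤ 2 ^ ω n
  length-divisors≤2^ω {n} 0<n sf = subst (length (divisors n) ≤_) (length-sublists primes)
    (injection⇒length≤ (List.≡-dec _≟_) primeFactors (divisors-unique n)
      (λ d∈ e∈ eq → ∣-antisym (∣-by-primeFactors d∈ eq) (∣-by-primeFactors e∈ (sym eq)))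
      (λ _ → filter∈sublists _ primes))
    where
    primes = filter prime? (divisors n)
    primeFactors : ℕ → List ℕ
    primeFactors d = filter (_∣? d) primes
    ∣-by-primeFactors : ∀ {d e} → d ∈ divisors n → primeFactors d ≡ primeFactors e → d ∣ e
    ∣-by-primeFactors {d} {e} d∈ eq =
      squarefree-∣ d (λ q q-prime q²∣d → sf q q-prime (∣-trans q²∣d d∣n)) p∣d⇒p∣e
      where
      d∣n = ∈-divisors⁻ d∈
      p∣d⇒p∣e : ∀ p → Prime p → p ∣ d → p ∣ e
      p∣d⇒p∣e p p-prime p∣d = proj₂ (∈-filter⁻ (_∣? e) {xs = primes} (subst (p ∈_) eq
        (∈-filter⁺ (_∣? d) (∈-filter⁺ prime? (∈-divisors⁺ 0<n (∣-trans p∣d d∣n)) p-prime) p∣d)))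

-- Integer-valued polynomial functions and finite differences

module _ where
  open import Data.Integer using (ℤ; +_; 0ℤ; 1ℤ; -1ℤ; _+_; _-_; _*_; _^_)
  import Data.Integer.Properties as ℤ
  open import Data.Integer.Divisibility.Signed using (_∣_; ∣m∣n⇒∣m-n; ∣⇒∣ᵤ)
  open import Data.Integer.Tactic.RingSolver using (solve-∀)
  open import Data.Nat using (_≟_; z≤n; s≤s)
  open import Data.Nat.Primality using (euclidsLemma)
  open import Data.List using (foldr)
  open import Data.List.Relation.Unary.Any using (here; there)
  open import Data.List.Extrema.Nat using (max; xs≤max; argmax-sel)
  open import Function using (id)

  monomial : ℕ → ℕ → ℤ
  monomial e x = (+ x) ^ e

  -- Degree< e f: f agrees on ℕ with an integer polynomial of degree < e, encoded by its
  -- coefficients read off from the top.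
  Degree< : ℕ → (ℕ → ℤ) → Set
  Degree< zero    f = ∀ x → f x ≡ 0ℤ
  Degree< (suc e) f = ∃[ a ] Degree< e (λ x → f x - a * monomial e x)

  LeadingTerm : ℕ → ℤ → (ℕ → ℤ) → Set
  LeadingTerm e a f = Degree< e (λ x → f x - a * monomial e x)

  Degree<-cong : ∀ e {f g} → (∀ x → f x ≡ g x) → Degree< e f → Degree< e g
  Degree<-cong zero    f≗g f<0 x = trans (sym (f≗g x)) (f<0 x)
  Degree<-cong (suc e) f≗g (a , f<e) =
    a , Degree<-cong e (λ x → cong (_- a * monomial e x) (f≗g x)) f<e

  Degree<⇒LeadingTerm : ∀ e {f} → Degree< e f → LeadingTerm e 0ℤ f
  Degree<⇒LeadingTerm e {f} f<e = Degree<-cong e (λ x → lemma (f x) (monomial e x)) f<e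
    where
    lemma : ∀ u w → u ≡ u - 0ℤ * w
    lemma = solve-∀

  Degree<-suc : ∀ e {f} → Degree< e f → Degree< (suc e) f
  Degree<-suc e f<e = 0ℤ , Degree<⇒LeadingTerm e f<e

  Degree<-mono : ∀ {d e f} → d ≤ e → Degree< d f → Degree< e f
  Degree<-mono {d} {e} {f} d≤e f<d = subst (λ k → Degree< k f) (ℕ.m∸n+n≡m d≤e) (raise (e ℕ.∸ d))
    where
    raise : ∀ k → Degree< (k ℕ.+ d) f
    raise zero    = f<d
    raise (suc k) = Degree<-suc _ (raise k)

  Degree<-0 : ∀ e → Degree< e (λ _ → 0ℤ)
  Degree<-0 zero    _ = refl
  Degree<-0 (suc e) = Degree<-suc e (Degree<-0 e)

  mutual
    Degree<-+ : ∀ e {f g} → Degree< e f → Degree< e g → Degree< e (λ x → f x + g x)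
    Degree<-+ zero    f<0 g<0 x = cong₂ _+_ (f<0 x) (g<0 x)
    Degree<-+ (suc e) {f} {g} (a , f-lead) (b , g-lead) = a + b , LeadingTerm-+ e {a} {b} {f} {g} f-lead g-lead

    LeadingTerm-+ : ∀ e {a b f g} → LeadingTerm e a f → LeadingTerm e b g →
                    LeadingTerm e (a + b) (λ x → f x + g x)
    LeadingTerm-+ e {a} {b} {f} {g} f-lead g-lead =
      Degree<-cong e (λ x → lemma (f x) (g x) a b (monomial e x)) (Degree<-+ e f-lead g-lead)
      where
      lemma : ∀ u v a b w → (u - a * w) + (v - b * w) ≡ (u + v) - (a + b) * w
      lemma = solve-∀

  Degree<-scale : ∀ e c {f} → Degree< e f → Degree< e (λ x → c * f x)
  Degree<-scale zero    c f<0 x = trans (cong (c *_) (f<0 x)) (ℤ.*-zeroʳ c)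
  Degree<-scale (suc e) c {f} (a , f<e) =
    c * a , Degree<-cong e (λ x → lemma c (f x) a (monomial e x)) (Degree<-scale e c f<e)
    where
    lemma : ∀ c u a w → c * (u - a * w) ≡ c * u - (c * a) * w
    lemma = solve-∀

  LeadingTerm-lower : ∀ e {a f g} → LeadingTerm e a f → Degree< e g →
                      LeadingTerm e a (λ x → f x - g x)
  LeadingTerm-lower e {a} {f} {g} f-lead g<e =
    Degree<-cong e (λ x → lemma (f x) a (monomial e x) (g x))
      (Degree<-+ e f-lead (Degree<-scale e -1ℤ g<e))
    where
    lemma : ∀ u a w v → (u - a * w) + -1ℤ * v ≡ (u - v) - a * w
    lemma = solve-∀

  LeadingTerm-monomial : ∀ e c → LeadingTerm e c (λ x → c * monomial e x)
  LeadingTerm-monomial e c = Degree<-cong e (λ x → lemma (c * monomial e x)) (Degree<-0 e)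
    where
    lemma : ∀ u → 0ℤ ≡ u - u
    lemma = solve-∀

  Degree<-monomial : ∀ e c → Degree< (suc e) (λ x → c * monomial e x)
  Degree<-monomial e c = c , LeadingTerm-monomial e c

  LeadingTerm-monomial-self : ∀ e → LeadingTerm e 1ℤ (monomial e)
  LeadingTerm-monomial-self e =
    Degree<-cong e (λ x → cong (_- 1ℤ * monomial e x) (ℤ.*-identityˡ (monomial e x)))
      (LeadingTerm-monomial e 1ℤ)

  LeadingTerm-monomial-lower : ∀ {d e} → d < e → LeadingTerm e 0ℤ (monomial d)
  LeadingTerm-monomial-lower {d} {e} d<e = Degree<⇒LeadingTerm e {monomial d}
    (Degree<-mono d<e (Degree<-cong (suc d) (λ x → ℤ.*-identityˡ (monomial d x)) (Degree<-monomial d 1ℤ)))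

  Degree<-*[1+x] : ∀ e {f} → Degree< e f → Degree< (suc e) (λ x → (1ℤ + + x) * f x)
  Degree<-*[1+x] zero    {f} f<0 =
    Degree<-suc 0 (λ x → trans (cong ((1ℤ + + x) *_) (f<0 x)) (ℤ.*-zeroʳ (1ℤ + + x)))
  Degree<-*[1+x] (suc e) {f} (b , f<e) =
    b , Degree<-cong (suc e) (λ x → lemma (+ x) (f x) b (monomial e x))
          (Degree<-+ (suc e) {λ x → (1ℤ + + x) * (f x - b * monomial e x)}
            (Degree<-*[1+x] e f<e) (Degree<-monomial e b))
    where
    lemma : ∀ y u b w → (1ℤ + y) * (u - b * w) + b * w ≡ (1ℤ + y) * u - b * (y * w)
    lemma = solve-∀

  Δ : (ℕ → ℤ) → ℕ → ℤ
  Δ f x = f (suc x) - f x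

  Δ^ : ℕ → (ℕ → ℤ) → ℕ → ℤ
  Δ^ zero    f = f
  Δ^ (suc k) f = Δ^ k (Δ f)

  -- (x+1)^(e+2) − x^(e+2) = (1 + x)((x+1)^(e+1) − x^(e+1)) + x^(e+1)
  Δ-monomial : ∀ e → LeadingTerm e (+ suc e) (Δ (monomial (suc e)))
  Δ-monomial zero    x = lemma (+ x)
    where
    lemma : ∀ u → ((1ℤ + u) * 1ℤ - u * 1ℤ) - 1ℤ * 1ℤ ≡ 0ℤ
    lemma = solve-∀
  Δ-monomial (suc e) =
    Degree<-cong (suc e) (λ x → lemma (+ x) (monomial (suc e) (suc x)) (monomial e x) (+ suc e))
      (Degree<-+ (suc e) {λ x → (1ℤ + + x) * (Δ (monomial (suc e)) x - + suc e * monomial e x)}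
        (Degree<-*[1+x] e (Δ-monomial e)) (Degree<-monomial e (+ suc e)))
    where
    lemma : ∀ u A B c → (1ℤ + u) * ((A - u * B) - c * B) + c * B
                        ≡ ((1ℤ + u) * A - u * (u * B)) - (1ℤ + c) * (u * B)
    lemma = solve-∀

  mutual
    Δ-Degree< : ∀ e {f} → Degree< (suc e) f → Degree< e (Δ f)
    Δ-Degree< zero    {f} (b , f-b≡0) x =
      trans (lemma (f (suc x)) (f x) (b * 1ℤ)) (cong₂ _-_ (f-b≡0 (suc x)) (f-b≡0 x))
      where
      lemma : ∀ u v c → u - v ≡ (u - c) - (v - c)
      lemma = solve-∀
    Δ-Degree< (suc e) {f} (b , f-lead) = + suc e * b , Δ-LeadingTerm e {b} {f} f-lead

    Δ-LeadingTerm : ∀ e {a f} → LeadingTerm (suc e) a f → LeadingTerm e (+ suc e * a) (Δ f)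
    Δ-LeadingTerm e {a} {f} f-lead =
      Degree<-cong e
        (λ x → lemma (f (suc x)) (f x) a (monomial (suc e) (suc x)) (monomial (suc e) x) (+ suc e) (monomial e x))
        (Degree<-+ e {Δ (λ x → f x - a * monomial (suc e) x)}
          (Δ-Degree< e {λ x → f x - a * monomial (suc e) x} f-lead)
          (Degree<-scale e a {λ x → Δ (monomial (suc e)) x - + suc e * monomial e x} (Δ-monomial e)))
      where
      lemma : ∀ u v a A B c w → ((u - a * A) - (v - a * B)) + a * ((A - B) - c * w)
                                ≡ (u - v) - (c * a) * w
      lemma = solve-∀

  Δ^-LeadingTerm : ∀ e {a f} → LeadingTerm e a f → ∀ x → Δ^ e f x ≡ + (e !) * a
  Δ^-LeadingTerm zero    {a} f-lead x = trans (ℤ.i-j≡0⇒i≡j _ _ (f-lead x)) (lemma a)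
    where
    lemma : ∀ a → a * 1ℤ ≡ + 1 * a
    lemma = solve-∀
  Δ^-LeadingTerm (suc e) {a} {f} f-lead x = begin
    Δ^ e (Δ f) x             ≡⟨ Δ^-LeadingTerm e {f = Δ f} (Δ-LeadingTerm e {a} {f} f-lead) x ⟩
    + (e !) * (+ suc e * a)  ≡⟨ lemma (+ (e !)) (+ suc e) a ⟩
    (+ suc e * + (e !)) * a  ≡⟨ cong (_* a) (ℤ.pos-* (suc e) (e !)) ⟨
    + (suc e !) * a          ∎
    where
    open ≡-Reasoning
    lemma : ∀ a b c → a * (b * c) ≡ (b * a) * c
    lemma = solve-∀

  Δ^-∣ : ∀ k {d f} → (∀ x → d ∣ f x) → ∀ x → d ∣ Δ^ k f x
  Δ^-∣ zero    d∣f = d∣f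
  Δ^-∣ (suc k) d∣f = Δ^-∣ k (λ x → ∣m∣n⇒∣m-n (d∣f (suc x)) (d∣f x))

  powerSum : List ℕ → ℤ → ℤ
  powerSum E x = foldr (λ d acc → x ^ d + acc) (+ 0) E

  -- T′ E generalises T to an arbitrary list of exponents: T n (+ x) is T′ (divisors n) x.
  T′ : List ℕ → ℕ → ℤ
  T′ E x = powerSum E (+ x) - + length E * + x

  multiplicity : ℕ → List ℕ → ℕ
  multiplicity d []      = 0
  multiplicity d (e ∷ E) with e ≟ d
  ... | yes _ = suc (multiplicity d E)
  ... | no  _ = multiplicity d E

  multiplicity≤length : ∀ d E → multiplicity d E ≤ length E
  multiplicity≤length d []      = z≤n
  multiplicity≤length d (e ∷ E) with e ≟ d
  ... | yes _ = s≤s (multiplicity≤length d E)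
  ... | no  _ = ℕ.m≤n⇒m≤1+n (multiplicity≤length d E)

  ∈⇒multiplicity>0 : ∀ {d E} → d ∈ E → 0 < multiplicity d E
  ∈⇒multiplicity>0 {d} {e ∷ E} d∈E with e ≟ d
  ∈⇒multiplicity>0 {d} {e ∷ E} _           | yes _   = s≤s z≤n
  ∈⇒multiplicity>0 {d} {e ∷ E} (here refl) | no  e≢d = ⊥-elim (e≢d refl)
  ∈⇒multiplicity>0 {d} {e ∷ E} (there d∈E) | no  _   = ∈⇒multiplicity>0 d∈E

  powerSum-LeadingTerm : ∀ D E → All (_≤ D) E →
                         LeadingTerm D (+ multiplicity D E) (λ x → powerSum E (+ x))
  powerSum-LeadingTerm D []      []          = Degree<⇒LeadingTerm D (Degree<-0 D)
  powerSum-LeadingTerm D (e ∷ E) (e≤D ∷ E≤D) with e ≟ D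
  ... | yes refl = LeadingTerm-+ D {1ℤ} {+ multiplicity D E} {monomial D} {λ x → powerSum E (+ x)}
                     (LeadingTerm-monomial-self D) (powerSum-LeadingTerm D E E≤D)
  ... | no  e≢D  = LeadingTerm-+ D {0ℤ} {+ multiplicity D E} {monomial e} {λ x → powerSum E (+ x)}
                     (LeadingTerm-monomial-lower (ℕ.≤∧≢⇒< e≤D e≢D)) (powerSum-LeadingTerm D E E≤D)

  T′-LeadingTerm : ∀ {D} E → 2 ≤ D → All (_≤ D) E → LeadingTerm D (+ multiplicity D E) (T′ E)
  T′-LeadingTerm {D} E 2≤D E≤D =
    LeadingTerm-lower D {+ multiplicity D E} {λ x → powerSum E (+ x)} {λ x → + length E * + x}
      (powerSum-LeadingTerm D E E≤D)
      (Degree<-mono 2≤D (Degree<-cong 2 (λ x → cong (+ length E *_) (ℤ.*-identityʳ (+ x)))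
                                        (Degree<-monomial 1 (+ length E))))

  -- If the largest exponent D were ≥ 2, the D-th finite difference of T′ E would be D! times
  -- the multiplicity of D, a product of two factors prime to p.
  ∣T′⇒exponents≤1 : ∀ {p} E → Prime p → length E < p → All (_< p) E →
                    (∀ x → + p ∣ T′ E x) → All (_≤ 1) E
  ∣T′⇒exponents≤1 {p} E p-prime |E|<p E<p p∣T′ with 2 ℕ.≤? max 0 E
  ... | no  D≱2 = All.map (λ e≤D → ℕ.≤-trans e≤D (ℕ.≤-pred (ℕ.≰⇒> D≱2))) (xs≤max 0 E)
  ... | yes 2≤D with argmax-sel id 0 E
  ...   | inj₁ D≡0 = ⊥-elim (ℕ.n≮0 (subst (1 <_) D≡0 2≤D))
  ...   | inj₂ D∈E = ⊥-elim (p∤D!*m p∣D!*m)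
    where
    D = max 0 E
    m = multiplicity D E
    Δ^T′≡D!*m : Δ^ D (T′ E) 0 ≡ + (D ! ℕ.* m)
    Δ^T′≡D!*m = trans (Δ^-LeadingTerm D (T′-LeadingTerm E 2≤D (xs≤max 0 E)) 0) (sym (ℤ.pos-* (D !) m))
    p∣D!*m : p ℕ.∣ D ! ℕ.* m
    p∣D!*m = ∣⇒∣ᵤ (subst (+ p ∣_) Δ^T′≡D!*m (Δ^-∣ D p∣T′ 0))
    p∤D!*m : ¬ p ℕ.∣ D ! ℕ.* m
    p∤D!*m p∣D!*m with euclidsLemma (D !) m p-prime p∣D!*m
    ... | inj₁ p∣D! = prime∤n! p-prime (All.lookup E<p D∈E) p∣D!
    ... | inj₂ p∣m  = ℕ.<⇒≱ (ℕ.≤-<-trans (multiplicity≤length D E) |E|<p)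
                            (ℕ.∣⇒≤ {{ℕ.>-nonZero (∈⇒multiplicity>0 D∈E)}} p∣m)

-- Prime factors of almost-primes

module _ where
  open import Data.Nat using (_%_; _/_; NonZero)
  open import Data.Nat.DivMod using (m≡m%n+[m/n]*n)
  open import Data.Nat.Primality using (prime⇒nonZero)
  open import Data.Integer using (+_; 0ℤ; _+_; _-_; _*_; _^_)
  import Data.Integer.Properties as ℤ
  open import Data.Integer.Divisibility.Signed using (_∣_; divides; ∣m∣n⇒∣m+n; ∣m∣n⇒∣m-n; ∣ᵤ⇒∣)
  open import Data.Integer.Tactic.RingSolver using (solve-∀)
  import Data.List.Properties as List
  open import Data.List.Membership.Propositional.Properties using (∈-map⁺)
  import Data.List.Relation.Unary.All.Properties as All
  open import Function using (_∘_)
  open ≡-Reasoning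

  pos-^ : ∀ a n → + (a ℕ.^ n) ≡ (+ a) ^ n
  pos-^ a zero    = refl
  pos-^ a (suc n) = trans (ℤ.pos-* a (a ℕ.^ n)) (cong ((+ a) *_) (pos-^ a n))

  %≡%⇒∣- : ∀ {p a b} .{{_ : NonZero p}} → a % p ≡ b % p → + p ∣ + a - + b
  %≡%⇒∣- {p} {a} {b} a≡b = divides (+ (a / p) - + (b / p)) (begin
    + a - + b
      ≡⟨ cong₂ (λ u v → + u - + v) (m≡m%n+[m/n]*n a p) (m≡m%n+[m/n]*n b p) ⟩
    + (a % p ℕ.+ a / p ℕ.* p) - + (b % p ℕ.+ b / p ℕ.* p)
      ≡⟨ cong (λ r → + (r ℕ.+ a / p ℕ.* p) - + (b % p ℕ.+ b / p ℕ.* p)) a≡b ⟩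
    + (b % p ℕ.+ a / p ℕ.* p) - + (b % p ℕ.+ b / p ℕ.* p)
      ≡⟨ cong₂ _-_ (embed (b % p) (a / p)) (embed (b % p) (b / p)) ⟩
    (+ (b % p) + + (a / p) * + p) - (+ (b % p) + + (b / p) * + p)
      ≡⟨ lemma (+ (b % p)) (+ (a / p)) (+ (b / p)) (+ p) ⟩
    (+ (a / p) - + (b / p)) * + p ∎)
    where
    embed : ∀ r q → + (r ℕ.+ q ℕ.* p) ≡ + r + + q * + p
    embed r q = trans (ℤ.pos-+ r (q ℕ.* p)) (cong (λ z → + r + z) (ℤ.pos-* q p))
    lemma : ∀ r x y p → (r + x * p) - (r + y * p) ≡ (x - y) * p
    lemma = solve-∀

  module _ {p} (p-prime : Prime p) where
    private instance
      p≢0 : NonZero p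
      p≢0 = prime⇒nonZero p-prime

    powerSum-reduce : ∀ x {L} → All (0 <_) L →
                      + p ∣ powerSum L (+ x) - powerSum (map (reduce p-prime) L) (+ x)
    powerSum-reduce x []            = divides 0ℤ refl
    powerSum-reduce x {d ∷ L} (0<d ∷ 0<L) =
      subst (+ p ∣_) (lemma ((+ x) ^ d) ((+ x) ^ r d) (powerSum L (+ x)) (powerSum (map r L) (+ x)))
        (∣m∣n⇒∣m+n (subst₂ (λ u v → + p ∣ u - v) (pos-^ x d) (pos-^ x (r d)) (%≡%⇒∣- (^-reduce p-prime x 0<d)))
                   (powerSum-reduce x 0<L))
      where
      r = reduce p-prime
      lemma : ∀ a b s t → (a - b) + (s - t) ≡ (a + s) - (b + t)
      lemma = solve-∀

    ∣T′⇒∣T′∘reduce : ∀ {L} → All (0 <_) L → (∀ x → + p ∣ T′ L x) →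
                     ∀ x → + p ∣ T′ (map (reduce p-prime) L) x
    ∣T′⇒∣T′∘reduce {L} 0<L p∣T′ x = subst (+ p ∣_) eq (∣m∣n⇒∣m-n (p∣T′ x) (powerSum-reduce x 0<L))
      where
      S  = powerSum L (+ x)
      S′ = powerSum (map (reduce p-prime) L) (+ x)
      lemma : ∀ s s′ k y → (s - k * y) - (s - s′) ≡ s′ - k * y
      lemma = solve-∀
      eq : T′ L x - (S - S′) ≡ T′ (map (reduce p-prime) L) x
      eq = trans (lemma S S′ (+ length L) (+ x))
                 (cong (λ k → S′ - + k * + x) (sym (List.length-map (reduce p-prime) L)))

    divisor≥prime : ∀ {n d} → WeaklyAlmostPrime n → p ℕ.∣ n → length (divisors n) < p →
                    d ∈ divisors n → 2 ≤ d → p ≤ d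
    divisor≥prime {n} (_ , n∣T) p∣n τ<p d∈ 2≤d =
      reduce≤1⇒p≤d p-prime 2≤d (All.lookup exponents≤1 (∈-map⁺ (reduce p-prime) d∈))
      where
      exponents≤1 : All (_≤ 1) (map (reduce p-prime) (divisors n))
      exponents≤1 = ∣T′⇒exponents≤1 _ p-prime
        (subst (_< p) (sym (List.length-map (reduce p-prime) (divisors n))) τ<p)
        (All.map⁺ (All.universal (reduce<p p-prime) (divisors n)))
        (∣T′⇒∣T′∘reduce (divisors-positive n) (λ x → ∣ᵤ⇒∣ (ℕ.∣-trans p∣n (n∣T (+ x)))))

  prime∣⇒≤length-divisors : ∀ {n p} → AlmostPrime n → Composite n → Prime p → p ℕ.∣ n →
                            p ≤ length (divisors n)
  prime∣⇒≤length-divisors {n} {p} (n-wap@(0<n , _) , sf) n-composite p-prime p∣n@(ℕ.divides m n≡m*p)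
    with p ℕ.≤? length (divisors n)
  ... | yes p≤τ = p≤τ
  ... | no  p≰τ = ⊥-elim (ℕ.<⇒≱ p<q q≤p)
    where
    τ<p = ℕ.≰⇒> p≰τ
    q-factor = prime-divisor (cofactor≥2 n-composite p-prime n≡m*p)
    q = proj₁ q-factor
    q-prime = proj₁ (proj₂ q-factor)
    q∣m = proj₂ (proj₂ q-factor)
    q∣n : q ℕ.∣ n
    q∣n = ℕ.∣-trans q∣m (ℕ.divides p (trans n≡m*p (ℕ.*-comm m p)))
    q≢p : q ≢ p
    q≢p q≡p = sf p p-prime (subst (p ℕ.* p ℕ.∣_) (sym n≡m*p) (ℕ.*-monoˡ-∣ p (subst (ℕ._∣ m) q≡p q∣m)))
    p≤q = divisor≥prime p-prime n-wap p∣n τ<p (∈-divisors⁺ 0<n q∣n) (prime⇒>1 q-prime)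
    p<q = ℕ.≤∧≢⇒< p≤q (q≢p ∘ sym)
    q≤p = divisor≥prime q-prime n-wap q∣n (ℕ.<-trans τ<p p<q) (∈-divisors⁺ 0<n p∣n) (prime⇒>1 p-prime)

corollary2p3 : ∀ (M : ℕ) → 0 < M →
    ∃[ B ] (∀ (n : ℕ) → AlmostPrime n → Composite n → ω n ≡ M → n ≤ B)
corollary2p3 M _ = (2 ℕ.^ M) ! , bound
  where
  bound : ∀ n → AlmostPrime n → Composite n → ω n ≡ M → n ≤ (2 ℕ.^ M) !
  bound n n-ap@((0<n , _) , sf) n-composite ωn≡M =
    ℕ.∣⇒≤ {{(2 ℕ.^ M) ℕ.!≢0}} (squarefree-∣ n sf p∣n⇒p∣B)
    where
    τ≤2^M : length (divisors n) ≤ 2 ℕ.^ M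
    τ≤2^M = subst (λ k → length (divisors n) ≤ 2 ℕ.^ k) ωn≡M (length-divisors≤2^ω 0<n sf)
    p∣n⇒p∣B : ∀ p → Prime p → p ℕ.∣ n → p ℕ.∣ (2 ℕ.^ M) !
    p∣n⇒p∣B p p-prime p∣n = m≤n⇒m∣n! (ℕ.<-trans (ℕ.s≤s ℕ.z≤n) (prime⇒>1 p-prime))
      (ℕ.≤-trans (prime∣⇒≤length-divisors n-ap n-composite p-prime p∣n) τ≤2^M)
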